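{- Let $w=1^s0^t\gamma\in\mathcal{L}_{\mathrm{PN}}$ with $s\ge1$, $t\ge1$, and $\gamma\in1\{0,1\}^*\cup\{\varepsilon\}$, and let $1\le i\le t$. If the values $F(\gamma,\cdot)$ and $P(\gamma,\cdot)$ are known (stored in arrays with constant-time access), then it can be decided in constant time whether $w'=\mathrm{swap}(w,s,s+i)$ is prefix normal.
   Context: For a binary word $x$ and $0\le k\le|x|$, let $P(x,k)$ be the number of $1$s in the length-$k$ prefix of $x$. Let $F(x,k)$ be the maximum number of $1$s in a length-$k$ substring of $x$. A binary word $x$ is prefix normal if $F(x,k)=P(x,k)$ for all $1\le k\le|x|$. $\mathcal{L}_{\mathrm{PN}}$ is the set of prefix normal words. $\varepsilon$ is the empty word. $\mathrm{swap}(w,a,b)$ exchanges the characters at positions $a$ and $b$ of $w$, with positions numbered from $1$. -}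

module Defs where

open import Data.Bool using (Bool; true; false; if_then_else_; _∧_; _∨_; not)
open import Data.Nat using (ℕ; zero; suc; _+_; _*_; _∸_; _≤_; _⊔_; _≤ᵇ_; _≡ᵇ_)
open import Data.Nat.Properties using (_≤?_)
open import Data.List using (List; []; _∷_; _++_; length; take; replicate)
open import Data.Product using (Σ; _×_)
open import Data.Sum using (_⊎_)
open import Relation.Nullary using (yes; no)
open import Relation.Binary.PropositionalEquality using (_≡_)

-- Binary words: true = 1, false = 0.
Word : Set
Word = List Bool

ones : Word → ℕ
ones [] = 0
ones (true ∷ x) = suc (ones x)
ones (false ∷ x) = ones x

P : Word → ℕ → ℕ
P x k = ones (take k x)

-- Scans all starting positions j with j + k ≤ |x|.
-- (For k > |x| there is no such factor and the value is 0; this case is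
--  irrelevant for prefix normality, which only inspects 1 ≤ k ≤ |x|.)
F : Word → ℕ → ℕ
F [] k = 0
F (b ∷ y) k with k ≤? length (b ∷ y)
... | yes _ = ones (take k (b ∷ y)) ⊔ F y k
... | no _ = 0

PrefixNormal : Word → Set
PrefixNormal x = (k : ℕ) → 1 ≤ k → k ≤ length x → F x k ≡ P x k

-- 0-indexed read/write (out of range: read false, write nothing)
get : Word → ℕ → Bool
get [] _ = false
get (b ∷ x) zero = b
get (b ∷ x) (suc n) = get x n

set : Word → ℕ → Bool → Word
set [] _ _ = []
set (b ∷ x) zero c = c ∷ x
set (b ∷ x) (suc n) c = b ∷ set x n c

-- swap(w,a,b): exchange characters at positions a and b (1-indexed)
swap : Word → ℕ → ℕ → Word
swap w a b = set (set w (a ∸ 1) (get w (b ∸ 1))) (b ∸ 1) (get w (a ∸ 1))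

StartsWith1OrEmpty : Word → Set
StartsWith1OrEmpty γ = (γ ≡ []) ⊎ Σ Word (λ γ' → γ ≡ true ∷ γ')

block : ℕ → ℕ → Word → Word
block s t γ = replicate s true ++ (replicate t false ++ γ)

-- A model of "constant-time decision with O(1)-access arrays F(γ,·), P(γ,·)".
-- A decision procedure is a FIXED finite expression (independent of the
-- input) built from the scalars s, t, i, |γ|, numeric constants,
-- arithmetic (+, monus, *), conditionals, comparisons, Boolean connectives,
-- and array lookups F(γ,e), P(γ,e).  Evaluating a fixed expression costs a
-- constant number of operations and array accesses.

data NExp : Set
data BExp : Set

data NExp where
  const : ℕ → NExp
  var-s var-t var-i len-γ : NExp
  _⊕_ _⊖_ _⊗_ : NExp → NExp → NExp
  ifN : BExp → NExp → NExp → NExp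
  lookF lookP : NExp → NExp

data BExp where
  tt ff : BExp
  _≤E_ _≡E_ : NExp → NExp → BExp
  andE orE : BExp → BExp → BExp
  notE : BExp → BExp

record Env : Set where
  constructor env
  field
    s t i lenγ : ℕ
    arrF arrP : ℕ → ℕ

evalN : Env → NExp → ℕ
evalB : Env → BExp → Bool
evalN ρ (const n) = n
evalN ρ var-s = Env.s ρ
evalN ρ var-t = Env.t ρ
evalN ρ var-i = Env.i ρ
evalN ρ len-γ = Env.lenγ ρ
evalN ρ (a ⊕ b) = evalN ρ a + evalN ρ b
evalN ρ (a ⊖ b) = evalN ρ a ∸ evalN ρ b
evalN ρ (a ⊗ b) = evalN ρ a * evalN ρ b
evalN ρ (ifN c a b) = if evalB ρ c then evalN ρ a else evalN ρ b
evalN ρ (lookF a) = Env.arrF ρ (evalN ρ a)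
evalN ρ (lookP a) = Env.arrP ρ (evalN ρ a)
evalB ρ tt = true
evalB ρ ff = false
evalB ρ (a ≤E b) = evalN ρ a ≤ᵇ evalN ρ b
evalB ρ (a ≡E b) = evalN ρ a ≡ᵇ evalN ρ b
evalB ρ (andE a b) = evalB ρ a ∧ evalB ρ b
evalB ρ (orE a b) = evalB ρ a ∨ evalB ρ b
evalB ρ (notE a) = not (evalB ρ a)

-- environment for input (s, t, i, γ): only the stored arrays of γ are visible
envOf : ℕ → ℕ → ℕ → Word → Env
envOf s t i γ = env s t i (length γ) (F γ) (P γ)

-- Write w′ = swap(w, s, s+i) = 1^a 0^i 1 0^r γ, where a = s − 1 and r = t − i.  A word is
-- prefix normal iff its prefix-ones function is subadditive.  The prefix-ones function of w′
-- is n ↦ n up to a, constant a up to a + i, and beyond a + i it agrees with that of w, namely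
-- a + 1 + P(γ, m − r) at a + i + 1 + m.  Checked range by range, subadditivity of w′ follows
-- from that of w together with two conditions, both also necessary: every factor of γ of
-- length at most a + i has at most a ones, i.e. F(γ, min(a + i, |γ|)) ≤ a; and
-- P(γ, a + i − 1 − r) < a, from comparing the prefix 1^a 0^i with the equally long factor
-- that starts at the moved 1.  Each condition is a single array look-up.
module Submission where

open import Data.Bool using (Bool; true; false; T; if_then_else_)
open import Data.Bool.Properties using (T-≡; T-∧)
open import Data.List using ([]; _∷_; _++_; length; drop; replicate)
open import Data.List.Properties using (take-all; take-[]; drop-[]; length-++; length-replicate)
open import Data.Nat
open import Data.Nat.Properties
open import Data.Nat.Tactic.RingSolver using (solve-∀)
open import Data.Product using (Σ; _×_; _,_)
open import Data.Product.Function.NonDependent.Propositional using (_×-⇔_)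
open import Function.Bundles using (_⇔_; mk⇔; Equivalence)
import Function.Properties.Equivalence as ⇔
open import Relation.Binary.PropositionalEquality
open import Relation.Nullary using (yes; no; contradiction)

open import Defs

factorOnes : Word → ℕ → ℕ → ℕ
factorOnes x j k = P (drop j x) k

P≤ : ∀ x n → P x n ≤ n
P≤ [] n rewrite take-[] {A = Bool} n = z≤n
P≤ (b ∷ x) zero = z≤n
P≤ (true ∷ x) (suc n) = s≤s (P≤ x n)
P≤ (false ∷ x) (suc n) = m≤n⇒m≤1+n (P≤ x n)

P-+ : ∀ x j k → P x (j + k) ≡ P x j + factorOnes x j k
P-+ x zero k = refl
P-+ [] (suc j) k rewrite take-[] {A = Bool} k = refl
P-+ (true ∷ x) (suc j) k = cong suc (P-+ x j k)
P-+ (false ∷ x) (suc j) k = P-+ x j k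

P-+-≤ : ∀ x j k → P x (j + k) ≤ P x j + k
P-+-≤ x j k = ≤-trans (≤-reflexive (P-+ x j k)) (+-monoʳ-≤ (P x j) (P≤ (drop j x) k))

P-mono : ∀ x {m n} → m ≤ n → P x m ≤ P x n
P-mono x {m} m≤n with m≤n⇒∃[o]m+o≡n m≤n
... | d , refl = ≤-trans (m≤m+n (P x m) _) (≤-reflexive (sym (P-+ x m d)))

P-saturated : ∀ x {n} → length x ≤ n → P x n ≡ P x (length x)
P-saturated x {n} len≤n =
  cong ones (trans (take-all n x len≤n) (sym (take-all (length x) x ≤-refl)))

P-⊓-length : ∀ x n → P x (n ⊓ length x) ≡ P x n
P-⊓-length x n with n ≤? length x
... | yes n≤len = cong (P x) (m≤n⇒m⊓n≡m n≤len)
... | no n≰len = trans (cong (P x) (m≥n⇒m⊓n≡n len≤n)) (sym (P-saturated x len≤n))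
  where
  len≤n : length x ≤ n
  len≤n = <⇒≤ (≰⇒> n≰len)

factorOnes≤F : ∀ x j k → j + k ≤ length x → factorOnes x j k ≤ F x k
factorOnes≤F [] j k _ rewrite drop-[] {A = Bool} j | take-[] {A = Bool} k = z≤n
factorOnes≤F (b ∷ y) j k j+k≤ with k ≤? length (b ∷ y)
factorOnes≤F (b ∷ y) zero k _ | yes _ = m≤m⊔n _ _
factorOnes≤F (b ∷ y) (suc j) k (s≤s j+k≤) | yes _ =
  ≤-trans (factorOnes≤F y j k j+k≤) (m≤n⊔m _ _)
... | no k≰ = contradiction (m+n≤o⇒n≤o j j+k≤) k≰

F-least : ∀ x k m → (∀ j → j + k ≤ length x → factorOnes x j k ≤ m) → F x k ≤ m
F-least [] k m _ = z≤n
F-least (b ∷ y) k m bound with k ≤? length (b ∷ y)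
... | yes k≤ = ⊔-lub (bound 0 k≤) (F-least y k m (λ j j+k≤ → bound (suc j) (s≤s j+k≤)))
... | no _ = z≤n

-- A factor running past the end of x is dominated by the last full factor of the same length.
factorOnes≤F′ : ∀ x j k → k ≤ length x → factorOnes x j k ≤ F x k
factorOnes≤F′ x j k k≤len with j + k ≤? length x
... | yes j+k≤len = factorOnes≤F x j k j+k≤len
... | no j+k≰len =
  ≤-trans (+-cancelˡ-≤ (P x j) _ _ shifted) (factorOnes≤F x j′ k (≤-reflexive j′+k≡len))
  where
  open ≤-Reasoning
  j′ : ℕ
  j′ = length x ∸ k
  j′+k≡len : j′ + k ≡ length x
  j′+k≡len = m∸n+n≡m k≤len
  len≤j+k : length x ≤ j + k
  len≤j+k = <⇒≤ (≰⇒> j+k≰len)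
  j′≤j : j′ ≤ j
  j′≤j = m≤n+o⇒m∸n≤o (length x) k (subst (length x ≤_) (+-comm j k) len≤j+k)
  shifted : P x j + factorOnes x j k ≤ P x j + factorOnes x j′ k
  shifted = begin
    P x j + factorOnes x j k   ≡⟨ P-+ x j k ⟨
    P x (j + k)                ≡⟨ P-saturated x len≤j+k ⟩
    P x (length x)             ≡⟨ cong (P x) j′+k≡len ⟨
    P x (j′ + k)               ≡⟨ P-+ x j′ k ⟩
    P x j′ + factorOnes x j′ k ≤⟨ +-monoˡ-≤ _ (P-mono x j′≤j) ⟩
    P x j + factorOnes x j′ k  ∎

Subadditive : (ℕ → ℕ) → ℕ → Set
Subadditive c n = ∀ j k → j + k ≤ n → c (j + k) ≤ c j + c k

prefixNormal⇔subadditive : ∀ x → PrefixNormal x ⇔ Subadditive (P x) (length x)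
prefixNormal⇔subadditive x = mk⇔ to from
  where
  open ≤-Reasoning
  to : PrefixNormal x → Subadditive (P x) (length x)
  to pn j zero _ = ≤-reflexive (P-+ x j 0)
  to pn j (suc k) j+k≤len = begin
    P x (j + suc k)                ≡⟨ P-+ x j (suc k) ⟩
    P x j + factorOnes x j (suc k) ≤⟨ +-monoʳ-≤ (P x j) (factorOnes≤F x j (suc k) j+k≤len) ⟩
    P x j + F x (suc k)            ≡⟨ cong (P x j +_) (pn (suc k) (s≤s z≤n) k≤len) ⟩
    P x j + P x (suc k)            ∎
    where
    k≤len : suc k ≤ length x
    k≤len = m+n≤o⇒n≤o j j+k≤len
  from : Subadditive (P x) (length x) → PrefixNormal x
  from sub k _ k≤len = ≤-antisym
    (F-least x k (P x k) λ j j+k≤len →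
      +-cancelˡ-≤ (P x j) _ _ (subst (_≤ P x j + P x k) (P-+ x j k) (sub j k j+k≤len)))
    (factorOnes≤F x 0 k k≤len)

P-replicate-true : ∀ a y n → n ≤ a → P (replicate a true ++ y) n ≡ n
P-replicate-true a y zero _ = refl
P-replicate-true (suc a) y (suc n) (s≤s n≤a) = cong suc (P-replicate-true a y n n≤a)

P-replicate-true-+ : ∀ a y m → P (replicate a true ++ y) (a + m) ≡ a + P y m
P-replicate-true-+ zero y m = refl
P-replicate-true-+ (suc a) y m = cong suc (P-replicate-true-+ a y m)

P-replicate-false : ∀ r y m → P (replicate r false ++ y) m ≡ P y (m ∸ r)
P-replicate-false zero y m = refl
P-replicate-false (suc r) y zero = refl
P-replicate-false (suc r) y (suc m) = P-replicate-false r y m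

length-replicate-++ : ∀ n (b : Bool) y → length (replicate n b ++ y) ≡ n + length y
length-replicate-++ n b y =
  trans (length-++ (replicate n b)) (cong (_+ length y) (length-replicate n))

get-zeros : ∀ i r y → get (replicate (suc i + r) false ++ y) i ≡ false
get-zeros zero r y = refl
get-zeros (suc i) r y = get-zeros i r y

set-zeros : ∀ i r y → set (replicate (suc i + r) false ++ y) i true ≡
                       replicate i false ++ (true ∷ (replicate r false ++ y))
set-zeros zero r y = refl
set-zeros (suc i) r y = cong (false ∷_) (set-zeros i r y)

swapped : ℕ → ℕ → ℕ → Word → Word
swapped a i r γ = replicate a true ++ (replicate i false ++ (true ∷ (replicate r false ++ γ)))

swap-block : ∀ a i r γ → 1 ≤ i →
  swap (block (suc a) (i + r) γ) (suc a) (suc a + i) ≡ swapped a i r γ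
swap-block zero (suc i) r γ _ = cong₂ _∷_ (get-zeros i r γ) (set-zeros i r γ)
-- Both swapped positions lie behind the leading 1, so swap commutes with dropping it.
swap-block (suc a) i r γ 1≤i = cong (true ∷_) (swap-block a i r γ 1≤i)

+-∸-≤ : ∀ m n o → m + n ∸ o ≤ m ∸ o + n
+-∸-≤ m n o = m≤n+o⇒m∸n≤o (m + n) o
  (≤-trans (+-monoˡ-≤ n (m≤n+m∸n m o)) (≤-reflexive (+-assoc o (m ∸ o) n)))

module SwapCriterion (a i r : ℕ) (γ : Word) where

  open ≤-Reasoning

  g : ℕ
  g = length γ

  f : ℕ → ℕ
  f = P γ

  w w′ : Word
  w = block (suc a) (i + r) γ
  w′ = swapped a i r γ

  c c′ : ℕ → ℕ
  c = P w
  c′ = P w′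

  N : ℕ
  N = a + i + suc (r + g)

  length-w′ : length w′ ≡ N
  length-w′ = begin-equality
    length w′
      ≡⟨ length-replicate-++ a true _ ⟩
    a + length (replicate i false ++ _)
      ≡⟨ cong (a +_) (length-replicate-++ i false _) ⟩
    a + (i + suc (length (replicate r false ++ γ)))
      ≡⟨ cong (λ n → a + (i + suc n)) (length-replicate-++ r false γ) ⟩
    a + (i + suc (r + g))
      ≡⟨ +-assoc a i _ ⟨
    N ∎

  length-w : length w ≡ N
  length-w = begin-equality
    length w
      ≡⟨ length-replicate-++ (suc a) true _ ⟩
    suc a + length (replicate (i + r) false ++ γ)
      ≡⟨ cong (suc a +_) (length-replicate-++ (i + r) false γ) ⟩
    suc a + (i + r + g)
      ≡⟨ shuffle a i r g ⟩
    N ∎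
    where
    shuffle : ∀ a i r g → suc a + (i + r + g) ≡ a + i + suc (r + g)
    shuffle = solve-∀

  prefixNormal⇔subadditive-N : ∀ x → length x ≡ N → PrefixNormal x ⇔ Subadditive (P x) N
  prefixNormal⇔subadditive-N x len≡N =
    subst (λ n → PrefixNormal x ⇔ Subadditive (P x) n) len≡N (prefixNormal⇔subadditive x)

  data Region : ℕ → Set where
    low  : ∀ {n} → n ≤ a → Region n
    mid  : ∀ d → d ≤ i → Region (a + d)
    high : ∀ m → Region (a + i + suc m)

  region : ∀ n → Region n
  region n with n ≤? a
  ... | yes n≤a = low n≤a
  ... | no n≰a with m≤n⇒∃[o]m+o≡n (<⇒≤ (≰⇒> n≰a))
  ... | d , refl with d ≤? i
  ... | yes d≤i = mid d d≤i
  ... | no d≰i with m≤n⇒∃[o]m+o≡n (≰⇒> d≰i)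
  ... | m , refl = subst Region (trans (+-assoc a i (suc m)) (cong (a +_) (+-suc i m))) (high m)

  c′-low : ∀ {n} → n ≤ a → c′ n ≡ n
  c′-low {n} n≤a = P-replicate-true a _ n n≤a

  c′-mid : ∀ d → d ≤ i → c′ (a + d) ≡ a
  c′-mid d d≤i = begin-equality
    c′ (a + d)                       ≡⟨ P-replicate-true-+ a _ d ⟩
    a + P (replicate i false ++ X) d ≡⟨ cong (a +_) (P-replicate-false i X d) ⟩
    a + P X (d ∸ i)                  ≡⟨ cong (λ n → a + P X n) (m≤n⇒m∸n≡0 d≤i) ⟩
    a + 0                            ≡⟨ +-identityʳ a ⟩
    a                                ∎
    where X = true ∷ (replicate r false ++ γ)

  c′-high : ∀ m → c′ (a + i + suc m) ≡ suc (a + f (m ∸ r))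
  c′-high m = begin-equality
    c′ (a + i + suc m)
      ≡⟨ cong c′ (+-assoc a i (suc m)) ⟩
    c′ (a + (i + suc m))
      ≡⟨ P-replicate-true-+ a _ _ ⟩
    a + P (replicate i false ++ X) (i + suc m)
      ≡⟨ cong (a +_) (P-replicate-false i X _) ⟩
    a + P X (i + suc m ∸ i)
      ≡⟨ cong (λ n → a + P X n) (m+n∸m≡n i (suc m)) ⟩
    a + suc (P (replicate r false ++ γ) m)
      ≡⟨ cong (λ n → a + suc n) (P-replicate-false r γ m) ⟩
    a + suc (f (m ∸ r))
      ≡⟨ +-suc a _ ⟩
    suc (a + f (m ∸ r)) ∎
    where X = true ∷ (replicate r false ++ γ)

  c-high : ∀ m → c (a + i + suc m) ≡ suc (a + f (m ∸ r))
  c-high m = begin-equality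
    c (a + i + suc m)
      ≡⟨ cong c shift ⟩
    c (suc a + (i + m))
      ≡⟨ P-replicate-true-+ (suc a) _ (i + m) ⟩
    suc a + P (replicate (i + r) false ++ γ) (i + m)
      ≡⟨ cong (suc a +_) (P-replicate-false (i + r) γ (i + m)) ⟩
    suc a + f (i + m ∸ (i + r))
      ≡⟨ cong (λ n → suc a + f n) ([m+n]∸[m+o]≡n∸o i m r) ⟩
    suc (a + f (m ∸ r)) ∎
    where
    shift : a + i + suc m ≡ suc a + (i + m)
    shift = trans (+-assoc a i (suc m)) (trans (cong (a +_) (+-suc i m)) (+-suc a (i + m)))

  c′-high-shifted : ∀ m → c′ (a + i + suc (r + m)) ≡ suc (a + f m)
  c′-high-shifted m = trans (c′-high (r + m)) (cong (λ n → suc (a + f n)) (m+n∸m≡n r m))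

  c′≡c-high : ∀ m → c′ (a + i + suc m) ≡ c (a + i + suc m)
  c′≡c-high m = trans (c′-high m) (sym (c-high m))

  c′≤a : ∀ {n} → n ≤ a + i → c′ n ≤ a
  c′≤a {n} n≤a+i with region n
  ... | low n≤a = ≤-trans (≤-reflexive (c′-low n≤a)) n≤a
  ... | mid d d≤i = ≤-reflexive (c′-mid d d≤i)
  ... | high m = contradiction n≤a+i (m+1+n≰m (a + i))

  M : ℕ
  M = (a + i) ⊓ g

  p : ℕ
  p = a + i ∸ 1 ∸ r

  WindowBound : Set
  WindowBound = ∀ m ℓ → ℓ ≤ a + i → f (m + ℓ) ≤ f m + a

  windowBound : F γ M ≤ a → WindowBound
  windowBound F≤a m ℓ ℓ≤a+i = begin
    f (m + ℓ)              ≡⟨ P-⊓-length γ (m + ℓ) ⟨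
    f ((m + ℓ) ⊓ g)        ≤⟨ P-mono γ (⊓-mono-≤ (+-monoʳ-≤ m ℓ≤a+i) (m≤n+m g m)) ⟩
    f ((m + (a + i)) ⊓ (m + g)) ≡⟨ cong f (+-distribˡ-⊓ m (a + i) g) ⟨
    f (m + M)              ≡⟨ P-+ γ m M ⟩
    f m + factorOnes γ m M ≤⟨ +-monoʳ-≤ (f m) (factorOnes≤F′ γ m M (m⊓n≤n (a + i) g)) ⟩
    f m + F γ M            ≤⟨ +-monoʳ-≤ (f m) F≤a ⟩
    f m + a                ∎

  c′-+-comm : ∀ j k → c′ (k + j) ≤ c′ k + c′ j → c′ (j + k) ≤ c′ j + c′ k
  c′-+-comm j k = subst₂ (λ n m → c′ n ≤ m) (+-comm k j) (+-comm (c′ k) (c′ j))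

  c′-+-low : ∀ j {k} → k ≤ a → c′ (j + k) ≤ c′ j + c′ k
  c′-+-low j {k} k≤a =
    subst (λ n → c′ (j + k) ≤ c′ j + n) (sym (c′-low k≤a)) (P-+-≤ w′ j k)

  c′-+-mid : WindowBound → ∀ m d → d ≤ i →
             c′ (a + i + suc m + (a + d)) ≤ c′ (a + i + suc m) + c′ (a + d)
  c′-+-mid wb m d d≤i = begin
    c′ (a + i + suc m + ℓ)          ≡⟨ cong c′ (+-assoc (a + i) (suc m) ℓ) ⟩
    c′ (a + i + suc (m + ℓ))        ≡⟨ c′-high (m + ℓ) ⟩
    suc (a + f (m + ℓ ∸ r))         ≤⟨ s≤s (+-monoʳ-≤ a (P-mono γ (+-∸-≤ m ℓ r))) ⟩
    suc (a + f (m ∸ r + ℓ))         ≤⟨ s≤s (+-monoʳ-≤ a (wb (m ∸ r) ℓ ℓ≤a+i)) ⟩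
    suc (a + (f (m ∸ r) + a))       ≡⟨ cong suc (+-assoc a _ a) ⟨
    suc (a + f (m ∸ r)) + a         ≡⟨ cong₂ _+_ (c′-high m) (c′-mid d d≤i) ⟨
    c′ (a + i + suc m) + c′ (a + d) ∎
    where
    ℓ : ℕ
    ℓ = a + d
    ℓ≤a+i : ℓ ≤ a + i
    ℓ≤a+i = +-monoʳ-≤ a d≤i

  c′-+-high : Subadditive c N → ∀ m m′ → a + i + suc m + (a + i + suc m′) ≤ N →
              c′ (a + i + suc m + (a + i + suc m′)) ≤
              c′ (a + i + suc m) + c′ (a + i + suc m′)
  c′-+-high sub m m′ ≤N = begin
    c′ (H + K)               ≡⟨ cong c′ (+-assoc (a + i) (suc m) K) ⟩
    c′ (a + i + suc (m + K)) ≡⟨ c′≡c-high (m + K) ⟩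
    c (a + i + suc (m + K))  ≡⟨ cong c (+-assoc (a + i) (suc m) K) ⟨
    c (H + K)                ≤⟨ sub H K ≤N ⟩
    c H + c K                ≡⟨ cong₂ _+_ (c′≡c-high m) (c′≡c-high m′) ⟨
    c′ H + c′ K              ∎
    where
    H K : ℕ
    H = a + i + suc m
    K = a + i + suc m′

  c′≤a+a : f p < a → ∀ n → n ≤ a + i + (a + i) → c′ n ≤ a + a
  c′≤a+a fp<a n n≤ with region n
  ... | low n≤a = ≤-trans (≤-reflexive (c′-low n≤a)) (≤-trans n≤a (m≤m+n a a))
  ... | mid d d≤i = ≤-trans (≤-reflexive (c′-mid d d≤i)) (m≤m+n a a)
  ... | high m = begin
    c′ (a + i + suc m)  ≡⟨ c′-high m ⟩
    suc (a + f (m ∸ r)) ≡⟨ +-suc a _ ⟨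
    a + suc (f (m ∸ r)) ≤⟨ +-monoʳ-≤ a (≤-trans (s≤s (P-mono γ m∸r≤p)) fp<a) ⟩
    a + a               ∎
    where
    m∸r≤p : m ∸ r ≤ p
    m∸r≤p = ∸-monoˡ-≤ r (∸-monoˡ-≤ 1 (+-cancelˡ-≤ (a + i) (suc m) (a + i) n≤))

  sufficient : WindowBound → f p < a → Subadditive c N → Subadditive c′ N
  sufficient wb fp<a sub j k j+k≤N with region j | region k
  ... | _ | low k≤a = c′-+-low j k≤a
  ... | low j≤a | _ = c′-+-comm j k (c′-+-low k j≤a)
  ... | mid d d≤i | mid d′ d′≤i = begin
    c′ (a + d + (a + d′))    ≤⟨ c′≤a+a fp<a _ (+-mono-≤ (+-monoʳ-≤ a d≤i) (+-monoʳ-≤ a d′≤i)) ⟩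
    a + a                    ≡⟨ cong₂ _+_ (c′-mid d d≤i) (c′-mid d′ d′≤i) ⟨
    c′ (a + d) + c′ (a + d′) ∎
  ... | mid d d≤i | high m = c′-+-comm j k (c′-+-mid wb m d d≤i)
  ... | high m | mid d d≤i = c′-+-mid wb m d d≤i
  ... | high m | high m′ = c′-+-high sub m m′ j+k≤N

  windowBound-necessary : Subadditive c′ N → ∀ m ℓ → ℓ ≤ a + i → m + ℓ ≤ g →
                          f (m + ℓ) ≤ f m + a
  windowBound-necessary sub m ℓ ℓ≤a+i m+ℓ≤g = +-cancelˡ-≤ a _ _ (s≤s⁻¹ (begin
    suc (a + f (m + ℓ))            ≡⟨ c′-high-shifted (m + ℓ) ⟨
    c′ (a + i + suc (r + (m + ℓ))) ≡⟨ cong c′ shift ⟨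
    c′ (h + ℓ)                     ≤⟨ sub h ℓ (subst (_≤ N) (sym shift) h+ℓ≤N) ⟩
    c′ h + c′ ℓ                    ≤⟨ +-monoˡ-≤ (c′ ℓ) (≤-reflexive (c′-high-shifted m)) ⟩
    suc (a + f m) + c′ ℓ           ≤⟨ +-monoʳ-≤ (suc (a + f m)) (c′≤a ℓ≤a+i) ⟩
    suc (a + f m) + a              ≡⟨ cong suc (+-assoc a (f m) a) ⟩
    suc (a + (f m + a))            ∎))
    where
    h : ℕ
    h = a + i + suc (r + m)
    shift : h + ℓ ≡ a + i + suc (r + (m + ℓ))
    shift = trans (+-assoc (a + i) (suc (r + m)) ℓ) (cong (λ n → a + i + suc n) (+-assoc r m ℓ))
    h+ℓ≤N : a + i + suc (r + (m + ℓ)) ≤ N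
    h+ℓ≤N = +-monoʳ-≤ (a + i) (s≤s (+-monoʳ-≤ r m+ℓ≤g))

  F≤a-necessary : Subadditive c′ N → F γ M ≤ a
  F≤a-necessary sub = F-least γ M a λ j j+M≤g → +-cancelˡ-≤ (f j) _ _
    (subst (_≤ f j + a) (P-+ γ j M) (windowBound-necessary sub j M (m⊓n≤m (a + i) g) j+M≤g))

  f[m∸r]<a-necessary : Subadditive c′ N →
                       ∀ m → suc m ≤ a + i → m ≤ r + g → f (m ∸ r) < a
  f[m∸r]<a-necessary sub m m<a+i m≤r+g = +-cancelˡ-≤ a _ _ (begin
    a + suc (f (m ∸ r))     ≡⟨ +-suc a _ ⟩
    suc (a + f (m ∸ r))     ≡⟨ c′-high m ⟨
    c′ (a + i + suc m)      ≤⟨ sub (a + i) (suc m) (+-monoʳ-≤ (a + i) (s≤s m≤r+g)) ⟩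
    c′ (a + i) + c′ (suc m) ≤⟨ +-mono-≤ (≤-reflexive (c′-mid i ≤-refl)) (c′≤a m<a+i) ⟩
    a + a                   ∎)

  -- m is chosen so that m ∸ r = p ⊓ g, on which f agrees with f p.
  fp<a-necessary : 1 ≤ i → Subadditive c′ N → f p < a
  fp<a-necessary 1≤i sub = subst (_< a) f[m∸r]≡fp
    (f[m∸r]<a-necessary sub m m<a+i (m⊓n≤n (a + i ∸ 1) (r + g)))
    where
    m : ℕ
    m = (a + i ∸ 1) ⊓ (r + g)
    m<a+i : suc m ≤ a + i
    m<a+i = ≤-trans (s≤s (m⊓n≤m (a + i ∸ 1) (r + g)))
      (≤-reflexive (m+[n∸m]≡n (≤-trans 1≤i (m≤n+m i a))))
    f[m∸r]≡fp : f (m ∸ r) ≡ f p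
    f[m∸r]≡fp = begin-equality
      f (m ∸ r)           ≡⟨ cong f (∸-distribʳ-⊓ r (a + i ∸ 1) (r + g)) ⟩
      f (p ⊓ (r + g ∸ r)) ≡⟨ cong (λ n → f (p ⊓ n)) (m+n∸m≡n r g) ⟩
      f (p ⊓ g)           ≡⟨ P-⊓-length γ p ⟩
      f p                 ∎

  swap-criterion : 1 ≤ i → PrefixNormal w → PrefixNormal w′ ⇔ (F γ M ≤ a × f p < a)
  swap-criterion 1≤i pn = mk⇔
    (λ pn′ → let sub′ = to w′-sub pn′ in F≤a-necessary sub′ , fp<a-necessary 1≤i sub′)
    (λ (F≤a , fp<a) → from w′-sub (sufficient (windowBound F≤a) fp<a (to w-sub pn)))
    where
    open Equivalence
    w-sub : PrefixNormal w ⇔ Subadditive c N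
    w-sub = prefixNormal⇔subadditive-N w length-w
    w′-sub : PrefixNormal w′ ⇔ Subadditive c′ N
    w′-sub = prefixNormal⇔subadditive-N w′ length-w′

if-≤ᵇ≡⊓ : ∀ m n → (if m ≤ᵇ n then m else n) ≡ m ⊓ n
if-≤ᵇ≡⊓ m n with m ≤ᵇ n in m≤ᵇn
... | true = sym (m≤n⇒m⊓n≡m (≤ᵇ⇒≤ m n (subst T (sym m≤ᵇn) _)))
... | false = sym (m≥n⇒m⊓n≡n (≰⇒≥ (λ m≤n → subst T m≤ᵇn (≤⇒≤ᵇ m≤n))))

T-≤ᵇ : ∀ {m n} → T (m ≤ᵇ n) ⇔ m ≤ n
T-≤ᵇ = mk⇔ (≤ᵇ⇒≤ _ _) ≤⇒≤ᵇ

windowLength prefixLength : NExp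
windowLength = ifN (((var-s ⊕ var-i) ⊖ const 1) ≤E len-γ) ((var-s ⊕ var-i) ⊖ const 1) len-γ
prefixLength = ((var-s ⊕ var-i) ⊖ const 2) ⊖ (var-t ⊖ var-i)

swapCheck : BExp
swapCheck = andE (lookF windowLength ≤E (var-s ⊖ const 1))
                 ((const 1 ⊕ lookP prefixLength) ≤E (var-s ⊖ const 1))

evalB-swapCheck : ∀ a i r γ → (evalB (envOf (suc a) (i + r) i γ) swapCheck ≡ true) ⇔
                  (F γ ((a + i) ⊓ length γ) ≤ a × P γ (a + i ∸ 1 ∸ r) < a)
evalB-swapCheck a i r γ =
  subst₂ (λ m q → (evalB (envOf (suc a) (i + r) i γ) swapCheck ≡ true) ⇔
                  (F γ m ≤ a × P γ q < a))
    (if-≤ᵇ≡⊓ (a + i) (length γ)) (cong (a + i ∸ 1 ∸_) (m+n∸m≡n i r))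
    (⇔.trans (⇔.sym T-≡) (⇔.trans T-∧ (T-≤ᵇ ×-⇔ T-≤ᵇ)))

swapCheck-correct : (s t i : ℕ) (γ : Word) → 1 ≤ s → 1 ≤ t →
    StartsWith1OrEmpty γ → PrefixNormal (block s t γ) → 1 ≤ i → i ≤ t →
    ((evalB (envOf s t i γ) swapCheck ≡ true) ⇔ PrefixNormal (swap (block s t γ) s (s + i)))
swapCheck-correct (suc a) t i γ (s≤s z≤n) _ _ pn 1≤i i≤t with m≤n⇒∃[o]m+o≡n i≤t
... | r , refl rewrite swap-block a i r γ 1≤i =
  ⇔.trans (evalB-swapCheck a i r γ) (⇔.sym (swap-criterion 1≤i pn))
  where open SwapCriterion a i r γ

corollary1 : Σ BExp (λ e → (s t i : ℕ) (γ : Word) → 1 ≤ s → 1 ≤ t →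
    StartsWith1OrEmpty γ → PrefixNormal (block s t γ) → 1 ≤ i → i ≤ t →
    ((evalB (envOf s t i γ) e ≡ true) ⇔ PrefixNormal (swap (block s t γ) s (s + i))))
corollary1 = swapCheck , swapCheck-correct
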